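{- Let $s\ge2$, $k\ge1$, $0\le t\le k$, $\lambda\ge1$ be integers and let $Y=\{\mathbf y\in[s]^k: d(\mathbf y,\mathbf 1)>t\}$. Define $H_{k,s,t}$ as follows: if $t=0$, $H_{k,s,t}$ is the group of all permutations of $Y$ (so $H_{k,s,t}\cong S_{s^k-1}$); if $0<t<k$ and ($k>t+1$ or $s>2$), $H_{k,s,t}$ is the group of permutations of $Y$ induced by the maps $[s]^k\to[s]^k$ that permute the $k$ coordinates and, independently in each coordinate, permute the levels $\{2,\dots,s\}$ while fixing level $1$ (these maps preserve $Y$, and $H_{k,s,t}\cong S_{s-1}\wr S_k$); otherwise $H_{k,s,t}$ is the trivial group. Then $H_{k,s,t}$, acting on $\mathbb R^m$ by permuting coordinates $N_{\mathbf y}\mapsto N_{h(\mathbf y)}$, is a subgroup of $\Pi(\mathrm{OAP}(k,s,t,\lambda))$.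
   Context: Let $\{a_c\}$ be defined by $a_0=\lambda$, $a_c=\lambda-\sum_{e=0}^{c-1}a_e\binom{k-t}{c-e}(s-1)^{c-e}$ for $c\ge1$. Write $[s]=\{1,\dots,s\}$, $\mathbf 1=(1,\dots,1)\in[s]^k$, and $d(\mathbf u,\mathbf v)$ for the Hamming distance on $[s]^k$. For $\mathbf x\in[s]^k$ let $I_{\mathbf x}=\{i:x_i\ne1\}$, $J_{\mathbf x}=\{\mathbf y\in[s]^k: y_i=x_i\ \forall i\in I_{\mathbf x}\}$. Let $m=|Y|=\sum_{i=t+1}^k\binom{k}{i}(s-1)^i$. The LP relaxation orthogonal array polytope $\mathrm{OAP}(k,s,t,\lambda)\subseteq\mathbb R^m$ is the set of real vectors $(N_{\mathbf y})_{\mathbf y\in Y}$ satisfying $N_{\mathbf y}\ge0$ for all $\mathbf y\in Y$ and, for every $\mathbf x\in[s]^k$ with $0\le d(\mathbf 1,\mathbf x)\le t$, $a_{t-d(\mathbf 1,\mathbf x)}+(-1)^{t-d(\mathbf 1,\mathbf x)+1}\sum_{\mathbf y\in J_{\mathbf x}\cap Y}\binom{d(\mathbf 1,\mathbf y)-d(\mathbf 1,\mathbf x)-1}{t-d(\mathbf 1,\mathbf x)}N_{\mathbf y}\ge0$. For a full-dimensional polytope $P\subseteq\mathbb R^m$, a permutation symmetry of $P$ is a permutation of the coordinates of $\mathbb R^m$ that maps $P$ onto itself; the group of all of them is the permutation symmetry group $\Pi(P)$. -}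

module Defs where

open import Level using (Level; _⊔_) renaming (suc to lsuc)
open import Data.Bool using (Bool; true; false; if_then_else_; _∧_)
open import Data.Nat as ℕ using (ℕ; zero; suc; _∸_; _^_; _<?_)
open import Data.Nat.Combinatorics using (_C_)
open import Data.Integer as ℤ using (ℤ; +_; -[1+_])
open import Data.Fin using (Fin; zero; suc)
open import Data.Fin.Properties using () renaming (_≟_ to _≟ᶠ_)
open import Data.Fin.Permutation using (Permutation′; _⟨$⟩ʳ_)
open import Data.Vec using (Vec; []; _∷_; lookup; tabulate)
open import Data.List using (List; []; _∷_; [_]; map; concatMap; allFin; zip; upTo; foldr)
open import Data.Product using (Σ; ∃; ∃₂; _×_; _,_; proj₁)
open import Data.Sum using (_⊎_)
open import Data.Unit using (⊤)
open import Relation.Nullary using (¬_; yes; no; does)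
open import Relation.Binary using (Rel; IsTotalOrder)
open import Relation.Binary.PropositionalEquality using (_≡_)
open import Algebra.Bundles using (CommutativeRing)
open import Function.Bundles using (_↔_; Inverse)

-- Ordered commutative rings (ℝ is an instance).  Since the standard
-- library has no real numbers, the polytope is taken with coordinates
-- in an arbitrary ordered commutative ring.

record OrderedCommRing (c ℓ₁ ℓ₂ : Level) : Set (lsuc (c ⊔ ℓ₁ ⊔ ℓ₂)) where
  field
    commutativeRing : CommutativeRing c ℓ₁
  open CommutativeRing commutativeRing public
  field
    _≤_          : Rel Carrier ℓ₂
    isTotalOrder : IsTotalOrder _≈_ _≤_
    +-mono-≤     : ∀ {x y} z → x ≤ y → (x + z) ≤ (y + z)
    *-nonneg     : ∀ {x y} → 0# ≤ x → 0# ≤ y → 0# ≤ (x * y)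

-- [s]^k as Vec (Fin s) k.  Level "1" of [s] is the element  zero : Fin s.

isOne : ∀ {s} → Fin s → Bool
isOne zero    = true
isOne (suc _) = false

-- weight y = d(1, y), the Hamming distance from the all-ones word.
wt : ∀ {s k} → Vec (Fin s) k → ℕ
wt []       = 0
wt (a ∷ as) = if isOne a then wt as else suc (wt as)

allVecs : (s k : ℕ) → List (Vec (Fin s) k)
allVecs s zero    = [ [] ]
allVecs s (suc k) = concatMap (λ a → map (a ∷_) (allVecs s k)) (allFin s)

Y : (s k t : ℕ) → Set
Y s k t = Σ (Vec (Fin s) k) (λ y → t ℕ.< wt y)

collectY : ∀ {s k} (t : ℕ) → List (Vec (Fin s) k) → List (Y s k t)
collectY t [] = []
collectY t (y ∷ ys) with t <? wt y
... | yes p = (y , p) ∷ collectY t ys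
... | no _  = collectY t ys

allY : (s k t : ℕ) → List (Y s k t)
allY s k t = collectY t (allVecs s k)

inJ : ∀ {s k} → Vec (Fin s) k → Vec (Fin s) k → Bool
inJ []       []       = true
inJ (a ∷ as) (b ∷ bs) = (if isOne a then true else does (a ≟ᶠ b)) ∧ inJ as bs

-- The integer sequence a_c:
--   a_0 = λ,  a_c = λ - Σ_{e=0}^{c-1} a_e C(k-t, c-e) (s-1)^(c-e).

sumℤ : List ℤ → ℤ
sumℤ = foldr ℤ._+_ (+ 0)

-- aPrev s k t lam c = [a_0, …, a_(c-1)]
aStep : (s k t lam c : ℕ) → List ℤ → ℤ
aStep s k t lam c prev =
  + lam ℤ.- sumℤ (map (λ { (e , ae) → ae ℤ.* + (((k ∸ t) C (c ∸ e)) ℕ.* ((s ∸ 1) ^ (c ∸ e))) })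
                      (zip (upTo c) prev))

aPrev : (s k t lam c : ℕ) → List ℤ
aPrev s k t lam zero    = []
aPrev s k t lam (suc c) = aPrev s k t lam c Data.List.++ [ aStep s k t lam c (aPrev s k t lam c) ]

aSeq : (s k t lam c : ℕ) → ℤ
aSeq s k t lam c = aStep s k t lam c (aPrev s k t lam c)

module _ {c ℓ₁ ℓ₂} (R : OrderedCommRing c ℓ₁ ℓ₂) where
  open OrderedCommRing R

  natR : ℕ → Carrier
  natR zero    = 0#
  natR (suc n) = 1# + natR n

  intR : ℤ → Carrier
  intR (+ n)      = natR n
  intR -[1+ n ]   = - natR (suc n)

  signR : ℕ → Carrier
  signR zero    = - 1#
  signR (suc j) = - signR j

  sumR : ∀ {A : Set} → List A → (A → Carrier) → Carrier
  sumR xs f = foldr (λ a acc → f a + acc) 0# xs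

  InOAP : (k s t lam : ℕ) → (Y s k t → Carrier) → Set (ℓ₂)
  InOAP k s t lam N =
    (∀ y → 0# ≤ N y) ×
    (∀ (x : Vec (Fin s) k) → wt x ℕ.≤ t →
       0# ≤ (intR (aSeq s k t lam (t ∸ wt x))
             + signR (t ∸ wt x)
               * sumR (allY s k t) (λ y →
                   if inJ x (proj₁ y)
                   then natR (((wt (proj₁ y) ∸ wt x) ∸ 1) C (t ∸ wt x)) * N y
                   else 0#)))

  -- A permutation σ of coordinates (N ↦ N ∘ σ, i.e. N_y ↦ N_{σ(y)})
  -- maps the set P ⊆ Carrier^Y onto itself.
  MapsOnto : ∀ {ℓ} {I : Set} → ((I → Carrier) → Set ℓ) → (I ↔ I) → Set (c ⊔ ℓ₁ ⊔ ℓ)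
  MapsOnto {I = I} P σ =
    (∀ N → P N → P (λ y → N (Inverse.to σ y))) ×
    (∀ M → P M → Σ (I → Carrier) λ N → P N × (∀ y → N (Inverse.to σ y) ≈ M y))

FixesOne : ∀ {s} → Permutation′ s → Set
FixesOne {s} τ = ∀ (j : Fin s) → isOne j ≡ true → isOne (τ ⟨$⟩ʳ j) ≡ true

act : ∀ {s k} → Permutation′ k → (Fin k → Permutation′ s) → Vec (Fin s) k → Vec (Fin s) k
act π τ x = tabulate (λ i → τ i ⟨$⟩ʳ lookup x (π ⟨$⟩ʳ i))

WreathInduced : ∀ {s k t} → (Y s k t ↔ Y s k t) → Set
WreathInduced {s} {k} h =
  Σ (Permutation′ k) λ π → Σ (Fin k → Permutation′ s) λ τ →
    (∀ i → FixesOne (τ i)) × (∀ y → proj₁ (Inverse.to h y) ≡ act π τ (proj₁ y))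

WreathCase : (k s t : ℕ) → Set
WreathCase k s t = (0 ℕ.< t) × (t ℕ.< k) × ((suc t ℕ.< k) ⊎ (2 ℕ.< s))

InH : (k s t : ℕ) → (Y s k t ↔ Y s k t) → Set
InH k s t h =
  (t ≡ 0 × ⊤)
  ⊎ (WreathCase k s t × WreathInduced h)
  ⊎ (¬ (t ≡ 0) × ¬ WreathCase k s t × (∀ y → Inverse.to h y ≡ y))

module Submission where

-- The polytope is cut out by non-negativity of the coordinates and by one
-- "row" constraint for each word x of weight ≤ t; the row of x involves the
-- entries N_y with y ∈ J_x, weighted by a binomial coefficient that depends
-- only on wt x and wt y.  If h carries the row of every x onto the row of
-- some x' of the same weight (a "row symmetry"), then N ↦ N ∘ h maps the
-- polytope into itself: the row sums agree after reindexing the sum over Y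
-- by the bijection h.  If h⁻¹ is a row symmetry as well, h maps the polytope
-- onto itself.
--
-- Any
-- surjective relabelling of [s]^k with these two properties through which h
-- acts makes h and h⁻¹ row symmetries; the wreath maps and the identity are
-- such relabellings.  For t = 0 every row is all of Y with coefficient 1,
-- so every permutation is a row symmetry.

open import Defs
open import Data.Nat using (ℕ; _≤_)
open import Function.Bundles using (_↔_)

open import Algebra.Bundles using (CommutativeMonoid)
open import Data.Bool using (Bool; true; if_then_else_; _∧_)
open import Data.Bool.Properties using (∧-commutativeMonoid)
open import Data.Fin using (Fin; zero; suc)
open import Data.Fin.Permutation using (Permutation′; _⟨$⟩ʳ_; _⟨$⟩ˡ_; inverseʳ; inverseˡ)
open import Data.Fin.Properties using () renaming (_≟_ to _≟ᶠ_)
open import Data.List using (List; []; _∷_; map; concatMap; allFin; filter; cartesianProductWith; foldr; _++_)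
open import Data.List.Membership.Propositional using (_∈_)
open import Data.List.Membership.Propositional.Properties
  using (∈-map⁺; ∈-map⁻; ∈-allFin; ∈-filter⁺; ∈-cartesianProductWith⁺)
open import Data.List.Membership.Propositional.Properties.WithK using (unique∧set⇒bag)
open import Data.List.Properties using (foldr-map; map-∘; map-cong; filter-accept; filter-reject)
open import Data.List.Relation.Binary.BagAndSetEquality using (∼bag⇒↭)
open import Data.List.Relation.Binary.Permutation.Propositional using (_↭_; ↭⇒↭ₛ′)
import Data.List.Relation.Binary.Permutation.Propositional.Properties as ↭
import Data.List.Relation.Binary.Permutation.Setoid.Properties as ↭ₛ
import Data.List.Relation.Unary.All as All
open import Data.List.Relation.Unary.AllPairs using ([]; _∷_)
open import Data.List.Relation.Unary.Any using (here)
open import Data.List.Relation.Unary.Unique.Propositional using (Unique)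
import Data.List.Relation.Unary.Unique.Propositional.Properties as Unique
open import Data.Nat using (zero; suc; _∸_; _<?_)
open import Data.Nat.Combinatorics using (_C_)
open import Data.Nat.Properties using (+-0-commutativeMonoid; <-irrelevant; 0∸n≡0; n≤0⇒n≡0)
open import Data.Product using (_×_; _,_; proj₁; proj₂; ∃-syntax)
open import Data.Sum using (inj₁; inj₂)
open import Data.Vec using (Vec; []; _∷_; lookup; tabulate)
open import Data.Vec.Properties using (∷-injective; lookup∘tabulate; tabulate∘lookup; tabulate-cong)
open import Function.Bundles using (Inverse; Injection; mk⇔)
open import Function.Properties.Inverse using (↔-sym; ↔⇒↣)
open import Relation.Binary.PropositionalEquality
  using (_≡_; refl; sym; trans; cong; cong₂; subst; module ≡-Reasoning)
open import Relation.Binary.Structures using (IsTotalOrder)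
open import Relation.Nullary using (yes; no; does)
open import Relation.Nullary.Decidable using (does-⇔)

open Inverse using (to; from; strictlyInverseˡ; strictlyInverseʳ)

bijection-injective : ∀ {a} {A : Set a} (g : A ↔ A) {x y : A} → to g x ≡ to g y → x ≡ y
bijection-injective g = Injection.injective (↔⇒↣ g)

-- A duplicate-free list containing every element of A is permuted by any
-- bijection of A; this is what allows sums over Y to be reindexed.
enumeration-↭ : ∀ {a} {A : Set a} (xs : List A) → Unique xs → (∀ z → z ∈ xs) →
  (g : A ↔ A) → map (to g) xs ↭ xs
enumeration-↭ xs unique complete g =
  ∼bag⇒↭ (unique∧set⇒bag (Unique.map⁺ (bijection-injective g) unique) unique
           (mk⇔ (λ _ → complete _) (λ _ → hit)))
  where
  hit : ∀ {z} → z ∈ map (to g) xs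
  hit {z} = subst (_∈ map (to g) xs) (strictlyInverseˡ g z) (∈-map⁺ (to g) (complete (from g z)))

concatMap≡cartesianProductWith : ∀ {A B C : Set} (f : A → B → C) (xs : List A) (ys : List B) →
  concatMap (λ a → map (f a) ys) xs ≡ cartesianProductWith f xs ys
concatMap≡cartesianProductWith f []       ys = refl
concatMap≡cartesianProductWith f (x ∷ xs) ys =
  cong (map (f x) ys ++_) (concatMap≡cartesianProductWith f xs ys)

allVecs-unique : ∀ s k → Unique (allVecs s k)
allVecs-unique s zero    = All.[] ∷ []
allVecs-unique s (suc k) =
  subst Unique (sym (concatMap≡cartesianProductWith _∷_ (allFin s) (allVecs s k)))
    (Unique.cartesianProductWith⁺ _∷_ ∷-injective (Unique.allFin⁺ s) (allVecs-unique s k))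

allVecs-complete : ∀ s k (v : Vec (Fin s) k) → v ∈ allVecs s k
allVecs-complete s zero    []      = here refl
allVecs-complete s (suc k) (a ∷ v) =
  subst (a ∷ v ∈_) (sym (concatMap≡cartesianProductWith _∷_ (allFin s) (allVecs s k)))
    (∈-cartesianProductWith⁺ _∷_ (∈-allFin a) (allVecs-complete s k v))

-- An element of Y is determined by its word: the proof of t < wt y is irrelevant.
Y-≡ : ∀ {s k t} {y y′ : Y s k t} → proj₁ y ≡ proj₁ y′ → y ≡ y′
Y-≡ {y = v , p} {.v , q} refl = cong (v ,_) (<-irrelevant p q)

collectY-words : ∀ {s k} t (vs : List (Vec (Fin s) k)) →
  map proj₁ (collectY t vs) ≡ filter (λ v → t <? wt v) vs
collectY-words t []       = refl
collectY-words t (v ∷ vs) with t <? wt v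
... | yes p = trans (cong (v ∷_) (collectY-words t vs)) (sym (filter-accept (λ v → t <? wt v) {v} {vs} p))
... | no ¬p = trans (collectY-words t vs) (sym (filter-reject (λ v → t <? wt v) {v} {vs} ¬p))

allY-unique : ∀ s k t → Unique (allY s k t)
allY-unique s k t =
  Unique.map⁻ (subst Unique (sym (collectY-words t (allVecs s k)))
                 (Unique.filter⁺ (λ v → t <? wt v) (allVecs-unique s k)))

allY-complete : ∀ s k t (y : Y s k t) → y ∈ allY s k t
allY-complete s k t (v , p) = fromWord (∈-map⁻ proj₁ v∈words)
  where
  v∈words : v ∈ map proj₁ (allY s k t)
  v∈words = subst (v ∈_) (sym (collectY-words t (allVecs s k)))
                  (∈-filter⁺ (λ v → t <? wt v) (allVecs-complete s k v) p)
  fromWord : ∃[ y′ ] y′ ∈ allY s k t × v ≡ proj₁ y′ → (v , p) ∈ allY s k t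
  fromWord (y′ , y′∈allY , v≡y′) = subst (_∈ allY s k t) (Y-≡ (sym v≡y′)) y′∈allY

module Sums {c ℓ₁ ℓ₂} (R : OrderedCommRing c ℓ₁ ℓ₂) where
  open OrderedCommRing R using (Carrier; _≈_; _+_; 0#; setoid; isEquivalence; +-isCommutativeMonoid)
  open import Relation.Binary.Reasoning.Setoid setoid

  sumR-as-foldr : ∀ {A : Set} (xs : List A) (f : A → Carrier) → sumR R xs f ≡ foldr _+_ 0# (map f xs)
  sumR-as-foldr xs f = sym (foldr-map _+_ f 0# xs)

  sumR-reindex : ∀ {A : Set} (xs : List A) → Unique xs → (∀ z → z ∈ xs) →
    (g : A ↔ A) {f f′ : A → Carrier} → (∀ a → f a ≡ f′ (to g a)) → sumR R xs f ≈ sumR R xs f′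
  sumR-reindex xs unique complete g {f} {f′} f≗f′∘g = begin
    sumR R xs f                              ≡⟨ sumR-as-foldr xs f ⟩
    foldr _+_ 0# (map f xs)                  ≡⟨ cong (foldr _+_ 0#) (map-cong f≗f′∘g xs) ⟩
    foldr _+_ 0# (map (λ a → f′ (to g a)) xs) ≡⟨ cong (foldr _+_ 0#) (map-∘ xs) ⟩
    foldr _+_ 0# (map f′ (map (to g) xs))    ≈⟨ ↭ₛ.foldr-commMonoid setoid +-isCommutativeMonoid
                                                  (↭⇒↭ₛ′ isEquivalence
                                                    (↭.map⁺ f′ (enumeration-↭ xs unique complete g))) ⟩
    foldr _+_ 0# (map f′ xs)                 ≡⟨ sym (sumR-as-foldr xs f′) ⟩
    sumR R xs f′                             ∎

module CoordinateSum {c ℓ} (M : CommutativeMonoid c ℓ) where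
  open CommutativeMonoid M using (Carrier; _≈_; setoid) renaming (trans to ≈-trans; reflexive to ≈-reflexive)
  open import Algebra.Properties.CommutativeMonoid.Sum M using (sum; sum-cong-≋; sum-permute)
  open import Relation.Binary.Reasoning.Setoid setoid

  coordSum : ∀ {s k} → (Fin s → Fin s → Carrier) → Vec (Fin s) k → Vec (Fin s) k → Carrier
  coordSum φ x y = sum (λ i → φ (lookup x i) (lookup y i))

  -- If every level permutation τᵢ preserves φ, the coordinate sum is
  -- invariant under the wreath action; the coordinate permutation π only
  -- reorders the summands.
  coordSum-act : ∀ {s k} (π : Permutation′ k) (τ : Fin k → Permutation′ s) (φ : Fin s → Fin s → Carrier) →
    (∀ i a b → φ (τ i ⟨$⟩ʳ a) (τ i ⟨$⟩ʳ b) ≈ φ a b) →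
    ∀ x y → coordSum φ (act π τ x) (act π τ y) ≈ coordSum φ x y
  coordSum-act π τ φ τ-invariant x y = begin
    coordSum φ (act π τ x) (act π τ y)
      ≈⟨ sum-cong-≋ (λ i → ≈-trans (≈-reflexive (cong₂ φ (lookup∘tabulate _ i) (lookup∘tabulate _ i)))
                                 (τ-invariant i _ _)) ⟩
    sum (λ i → φ (lookup x (π ⟨$⟩ʳ i)) (lookup y (π ⟨$⟩ʳ i)))
      ≈⟨ sum-permute (λ j → φ (lookup x j) (lookup y j)) π ⟨
    coordSum φ x y ∎

-- Weight and the J-relation are coordinatewise sums, in (ℕ, +) and (Bool, ∧).
module WeightSum = CoordinateSum +-0-commutativeMonoid
module JSum      = CoordinateSum ∧-commutativeMonoid

nonOne : ∀ {s} → Fin s → ℕ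
nonOne a = if isOne a then 0 else 1

agreesJ : ∀ {s} → Fin s → Fin s → Bool
agreesJ a b = if isOne a then true else does (a ≟ᶠ b)

wt-coordSum : ∀ {s k} (x : Vec (Fin s) k) → wt x ≡ WeightSum.coordSum (λ a _ → nonOne a) x x
wt-coordSum []          = refl
wt-coordSum (zero  ∷ x) = wt-coordSum x
wt-coordSum (suc _ ∷ x) = cong suc (wt-coordSum x)

inJ-coordSum : ∀ {s k} (x y : Vec (Fin s) k) → inJ x y ≡ JSum.coordSum agreesJ x y
inJ-coordSum []      []      = refl
inJ-coordSum (a ∷ x) (b ∷ y) = cong (agreesJ a b ∧_) (inJ-coordSum x y)

isOne⇒zero : ∀ {s} (a : Fin (suc s)) → isOne a ≡ true → a ≡ zero
isOne⇒zero zero _ = refl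

module LevelPermutation {s} (τ : Permutation′ s) (fixes : FixesOne τ) where

  isOne-τ : ∀ a → isOne (τ ⟨$⟩ʳ a) ≡ isOne a
  isOne-τ zero    = fixes zero refl
  isOne-τ (suc a) with τ ⟨$⟩ʳ suc a in τa≡zero
  ... | suc _ = refl
  ... | zero with () ← bijection-injective τ (trans τa≡zero (sym (isOne⇒zero _ (fixes zero refl))))

  nonOne-τ : ∀ a → nonOne (τ ⟨$⟩ʳ a) ≡ nonOne a
  nonOne-τ a = cong (if_then 0 else 1) (isOne-τ a)

  agreesJ-τ : ∀ a b → agreesJ (τ ⟨$⟩ʳ a) (τ ⟨$⟩ʳ b) ≡ agreesJ a b
  agreesJ-τ a b = cong₂ (if_then true else_) (isOne-τ a)
    (does-⇔ (mk⇔ (bijection-injective τ) (cong (τ ⟨$⟩ʳ_))) (τ ⟨$⟩ʳ a ≟ᶠ τ ⟨$⟩ʳ b) (a ≟ᶠ b))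

module WreathAction {s k} (π : Permutation′ k) (τ : Fin k → Permutation′ s)
                    (fixes : ∀ i → FixesOne (τ i)) where
  open LevelPermutation using (nonOne-τ; agreesJ-τ)
  open ≡-Reasoning

  wt-act : ∀ x → wt (act π τ x) ≡ wt x
  wt-act x = begin
    wt (act π τ x)                                               ≡⟨ wt-coordSum (act π τ x) ⟩
    WeightSum.coordSum (λ a _ → nonOne a) (act π τ x) (act π τ x)
      ≡⟨ WeightSum.coordSum-act π τ _ (λ i a _ → nonOne-τ (τ i) (fixes i) a) x x ⟩
    WeightSum.coordSum (λ a _ → nonOne a) x x                    ≡⟨ wt-coordSum x ⟨
    wt x                                                         ∎

  inJ-act : ∀ x y → inJ (act π τ x) (act π τ y) ≡ inJ x y
  inJ-act x y = begin
    inJ (act π τ x) (act π τ y)                       ≡⟨ inJ-coordSum (act π τ x) (act π τ y) ⟩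
    JSum.coordSum agreesJ (act π τ x) (act π τ y)
      ≡⟨ JSum.coordSum-act π τ agreesJ (λ i → agreesJ-τ (τ i) (fixes i)) x y ⟩
    JSum.coordSum agreesJ x y                         ≡⟨ inJ-coordSum x y ⟨
    inJ x y                                           ∎

  -- The preimage of x puts τ_{π⁻¹ j}⁻¹(x_{π⁻¹ j}) in coordinate j.
  act-surjective : ∀ x → ∃[ x′ ] act π τ x′ ≡ x
  act-surjective x = preimage , trans (tabulate-cong lands) (tabulate∘lookup x)
    where
    preimage : Vec (Fin s) k
    preimage = tabulate (λ j → τ (π ⟨$⟩ˡ j) ⟨$⟩ˡ lookup x (π ⟨$⟩ˡ j))
    lands : ∀ i → τ i ⟨$⟩ʳ lookup preimage (π ⟨$⟩ʳ i) ≡ lookup x i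
    lands i rewrite lookup∘tabulate (λ j → τ (π ⟨$⟩ˡ j) ⟨$⟩ˡ lookup x (π ⟨$⟩ˡ j)) (π ⟨$⟩ʳ i)
                  | inverseˡ π {i} = inverseʳ (τ i)

rowBinomial : ℕ → ℕ → ℕ → ℕ
rowBinomial t w v = ((v ∸ w) ∸ 1) C (t ∸ w)

coef : ∀ {s k} → ℕ → Vec (Fin s) k → Vec (Fin s) k → ℕ
coef t x v = rowBinomial t (wt x) (wt v)

RowsMatch : ∀ {s k t} → (Y s k t ↔ Y s k t) → Vec (Fin s) k → Vec (Fin s) k → Set
RowsMatch {t = t} g x x′ =
  ∀ y → (inJ x (proj₁ y) ≡ inJ x′ (proj₁ (to g y))) × (coef t x (proj₁ y) ≡ coef t x′ (proj₁ (to g y)))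

RowSymmetry : ∀ {s k t} → (Y s k t ↔ Y s k t) → Set
RowSymmetry {s} {k} {t} g = ∀ (x : Vec (Fin s) k) → wt x ≤ t → ∃[ x′ ] wt x′ ≡ wt x × RowsMatch g x x′

module RowConstraints {c ℓ₁ ℓ₂} (R : OrderedCommRing c ℓ₁ ℓ₂) where
  open OrderedCommRing R
    using (Carrier; _≈_; _+_; _*_; 0#; isTotalOrder; +-cong; *-cong)
    renaming (_≤_ to _≤ᴿ_; sym to ≈-sym; reflexive to ≈-reflexive)
  open Sums R using (sumR-reindex)

  rowSum : ∀ {s k} t → (Y s k t → Carrier) → Vec (Fin s) k → Carrier
  rowSum {s} {k} t N x =
    sumR R (allY s k t) (λ y → if inJ x (proj₁ y) then natR R (coef t x (proj₁ y)) * N y else 0#)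

  rowSum-transfer : ∀ {s k t} (g : Y s k t ↔ Y s k t) (N : Y s k t → Carrier) {x x′} →
    RowsMatch g x x′ → rowSum t (λ y → N (to g y)) x ≈ rowSum t N x′
  rowSum-transfer {s} {k} {t} g N match =
    sumR-reindex (allY s k t) (allY-unique s k t) (allY-complete s k t) g
      (λ y → cong₂ (λ b n → if b then natR R n * N (to g y) else 0#) (proj₁ (match y)) (proj₂ (match y)))

  rowSymmetry-preserves : ∀ {s k t} lam (g : Y s k t ↔ Y s k t) → RowSymmetry g →
    ∀ N → InOAP R k s t lam N → InOAP R k s t lam (λ y → N (to g y))
  rowSymmetry-preserves {s} {k} {t} lam g symmetry N (nonneg , rows) =
    (λ y → nonneg (to g y)) , transferRow
    where
    transferRow : ∀ x → wt x ≤ t → 0# ≤ᴿ (intR R (aSeq s k t lam (t ∸ wt x))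
                                          + signR R (t ∸ wt x) * rowSum t (λ y → N (to g y)) x)
    transferRow x wx with symmetry x wx
    ... | x′ , sameWt , match = IsTotalOrder.≤-respʳ-≈ isTotalOrder sameValue
                                  (rows x′ (subst (_≤ t) (sym sameWt) wx))
      where
      sameValue : intR R (aSeq s k t lam (t ∸ wt x′)) + signR R (t ∸ wt x′) * rowSum t N x′
                ≈ intR R (aSeq s k t lam (t ∸ wt x)) + signR R (t ∸ wt x) * rowSum t (λ y → N (to g y)) x
      sameValue = +-cong (≈-reflexive (cong (λ w → intR R (aSeq s k t lam (t ∸ w))) sameWt))
                         (*-cong (≈-reflexive (cong (λ w → signR R (t ∸ w)) sameWt))
                                 (≈-sym (rowSum-transfer g N {x} {x′} match)))

  rowSymmetry-mapsOnto : ∀ {s k t} lam (g : Y s k t ↔ Y s k t) →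
    RowSymmetry g → RowSymmetry (↔-sym g) → MapsOnto R (InOAP R k s t lam) g
  rowSymmetry-mapsOnto lam g forward backward =
    rowSymmetry-preserves lam g forward ,
    λ M M∈P → (λ y → M (from g y)) , rowSymmetry-preserves lam (↔-sym g) backward M M∈P ,
              λ y → ≈-reflexive (cong M (strictlyInverseʳ g y))

record Relabelling {s k t} (g : Y s k t ↔ Y s k t) : Set where
  field
    φ           : Vec (Fin s) k → Vec (Fin s) k
    wt-φ        : ∀ x → wt (φ x) ≡ wt x
    inJ-φ       : ∀ x y → inJ (φ x) (φ y) ≡ inJ x y
    φ-onto      : ∀ x → ∃[ x′ ] φ x′ ≡ x
    g-acts-by-φ : ∀ y → proj₁ (to g y) ≡ φ (proj₁ y)

module _ {s k t} {g : Y s k t ↔ Y s k t} (ρ : Relabelling g) where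
  open Relabelling ρ

  relabelling-forward : RowSymmetry g
  relabelling-forward x _ = φ x , wt-φ x , λ y →
    trans (sym (inJ-φ x (proj₁ y))) (cong (inJ (φ x)) (sym (g-acts-by-φ y))) ,
    cong₂ (rowBinomial t) (sym (wt-φ x)) (trans (sym (wt-φ (proj₁ y))) (cong wt (sym (g-acts-by-φ y))))

  relabelling-backward : RowSymmetry (↔-sym g)
  relabelling-backward x _ with φ-onto x
  ... | x′ , φx′≡x = x′ , trans (sym (wt-φ x′)) (cong wt φx′≡x) , λ y →
    trans (cong₂ inJ (sym φx′≡x) (word-of-preimage y)) (inJ-φ x′ (proj₁ (from g y))) ,
    cong₂ (rowBinomial t) (trans (cong wt (sym φx′≡x)) (wt-φ x′))
                          (trans (cong wt (word-of-preimage y)) (wt-φ (proj₁ (from g y))))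
    where
    word-of-preimage : ∀ y → proj₁ y ≡ φ (proj₁ (from g y))
    word-of-preimage y = trans (cong proj₁ (sym (strictlyInverseˡ g y))) (g-acts-by-φ (from g y))

wreathRelabelling : ∀ {s k t} (g : Y s k t ↔ Y s k t) → WreathInduced g → Relabelling g
wreathRelabelling g (π , τ , fixes , acts) = record
  { φ = act π τ ; wt-φ = wt-act ; inJ-φ = inJ-act ; φ-onto = act-surjective ; g-acts-by-φ = acts }
  where open WreathAction π τ fixes

identityRelabelling : ∀ {s k t} (g : Y s k t ↔ Y s k t) → (∀ y → to g y ≡ y) → Relabelling g
identityRelabelling g fixed = record
  { φ = λ x → x ; wt-φ = λ _ → refl ; inJ-φ = λ _ _ → refl ; φ-onto = λ x → x , refl
  ; g-acts-by-φ = λ y → cong proj₁ (fixed y) }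

allOnes-inJ : ∀ {s k} (x v : Vec (Fin s) k) → wt x ≡ 0 → inJ x v ≡ true
allOnes-inJ []          []      _ = refl
allOnes-inJ (zero ∷ x)  (_ ∷ v) w = allOnes-inJ x v w
allOnes-inJ (suc _ ∷ _) (_ ∷ _) ()

coef-t0 : ∀ {s k} (x v : Vec (Fin s) k) → coef 0 x v ≡ 1
coef-t0 x v = cong (((wt v ∸ wt x) ∸ 1) C_) (0∸n≡0 (wt x))

rowSymmetry-t0 : ∀ {s k} (g : Y s k 0 ↔ Y s k 0) → RowSymmetry g
rowSymmetry-t0 g x wx = x , refl , λ y →
  trans (allOnes-inJ x (proj₁ y) wx≡0) (sym (allOnes-inJ x (proj₁ (to g y)) wx≡0)) ,
  trans (coef-t0 x (proj₁ y)) (sym (coef-t0 x (proj₁ (to g y))))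
  where
  wx≡0 : wt x ≡ 0
  wx≡0 = n≤0⇒n≡0 wx

open RowConstraints using (rowSymmetry-mapsOnto)

theorem8 : ∀ {c ℓ₁ ℓ₂} (R : OrderedCommRing c ℓ₁ ℓ₂)
    (s k t lam : ℕ) → 2 ≤ s → 1 ≤ k → t ≤ k → 1 ≤ lam →
    (h : Y s k t ↔ Y s k t) → InH k s t h →
    MapsOnto R (InOAP R k s t lam) h
theorem8 R s k .0 lam _ _ _ _ h (inj₁ (refl , _)) =
  rowSymmetry-mapsOnto R lam h (rowSymmetry-t0 h) (rowSymmetry-t0 (↔-sym h))
theorem8 R s k t lam _ _ _ _ h (inj₂ (inj₁ (_ , wreath))) =
  rowSymmetry-mapsOnto R lam h (relabelling-forward ρ) (relabelling-backward ρ)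
  where ρ = wreathRelabelling h wreath
theorem8 R s k t lam _ _ _ _ h (inj₂ (inj₂ (_ , _ , fixed))) =
  rowSymmetry-mapsOnto R lam h (relabelling-forward ρ) (relabelling-backward ρ)
  where ρ = identityRelabelling h fixed
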